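{- If $T$ is a tree and $S_1,S_2$ are labelings with $(T,S_1)\in\mathscr{T}_{02,012}$ and $(T,S_2)\in\mathscr{T}_{02,012}$, then $S_1=S_2$.
   Context: A labeling of a tree assigns each vertex a status in $\{C,D\}$; statuses are kept under the operations. $(F_3,J^3)$: path $d',d,x,e,e'$ with statuses $D,D,C,D,D$. $(F_4,J^4)$: path $x,d,d'$ with statuses $C,D,D$. $O_9$: add to $(T',S')$ a disjoint copy of $(F_3,J^3)$ and an edge $ux$ with $u\in V(T')$ of status $C$ and $x$ the status-$C$ vertex of $F_3$. $O_{10}$: add a disjoint copy of $(F_4,J^4)$ and an edge $ux$ with $u\in V(T')$ of status $D$ and $x$ the status-$C$ vertex of $F_4$. $\mathscr{T}_{02,012}$ is the family of labeled trees $(T,S)$ for which there is a sequence $(T^1,S^1),\dots,(T^j,S^j)$, $j\ge1$, with $(T^1,S^1)$ a copy of $(F_3,J^3)$, $(T^j,S^j)=(T,S)$, each term obtained from the previous one by $O_9$ or $O_{10}$. -}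

module Defs where

open import Data.Nat using (ℕ; _+_)
open import Data.Fin using (Fin; zero; suc; _↑ˡ_; _↑ʳ_; splitAt; #_)
open import Data.Sum using ([_,_]′; _⊎_)
open import Data.Product using (_×_; _,_; Σ; ∃)
open import Data.List using (List; []; _∷_; map; _++_)
open import Data.List.Membership.Propositional using (_∈_)
open import Relation.Binary.PropositionalEquality using (_≡_)
open import Function.Bundles using (_⤖_; _⇔_; Bijection)

data Status : Set where
  C D : Status

-- A labeled graph on vertex set Fin n: symmetric edge relation given as a list
-- of (unordered) edges, together with a labeling.

-- (F₃, J³): path d', d, x, e, e'  = vertices 0,1,2,3,4 ; statuses D,D,C,D,D
F3-edges : List (Fin 5 × Fin 5)
F3-edges = (# 0 , # 1) ∷ (# 1 , # 2) ∷ (# 2 , # 3) ∷ (# 3 , # 4) ∷ []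

J3 : Fin 5 → Status
J3 zero = D
J3 (suc zero) = D
J3 (suc (suc zero)) = C
J3 (suc (suc (suc zero))) = D
J3 (suc (suc (suc (suc zero)))) = D

F3-x : Fin 5
F3-x = # 2

-- (F₄, J⁴): path x, d, d'  = vertices 0,1,2 ; statuses C,D,D
F4-edges : List (Fin 3 × Fin 3)
F4-edges = (# 0 , # 1) ∷ (# 1 , # 2) ∷ []

J4 : Fin 3 → Status
J4 zero = C
J4 (suc zero) = D
J4 (suc (suc zero)) = D

F4-x : Fin 3
F4-x = # 0

old : ∀ {n} k → Fin n × Fin n → Fin (n + k) × Fin (n + k)
old k (a , b) = a ↑ˡ k , b ↑ˡ k

new : ∀ {k} n → Fin k × Fin k → Fin (n + k) × Fin (n + k)
new n (a , b) = n ↑ʳ a , n ↑ʳ b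

attach-edges : ∀ {n k} → List (Fin n × Fin n) → List (Fin k × Fin k) →
               Fin n → Fin k → List (Fin (n + k) × Fin (n + k))
attach-edges {n} {k} E F u x =
  (u ↑ˡ k , n ↑ʳ x) ∷ (map (old k) E ++ map (new n) F)

attach-labels : ∀ {n k} → (Fin n → Status) → (Fin k → Status) → Fin (n + k) → Status
attach-labels {n} S J v = [ S , J ]′ (splitAt n v)

-- Concrete (canonically numbered) members of 𝒯_{02,012}, built by the
-- operations O₉ and O₁₀ starting from (F₃, J³).
data Built : (n : ℕ) → List (Fin n × Fin n) → (Fin n → Status) → Set where
  base : Built 5 F3-edges J3
  O9   : ∀ {n E S} → Built n E S → (u : Fin n) → S u ≡ C →
         Built (n + 5) (attach-edges E F3-edges u F3-x) (attach-labels S J3)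
  O10  : ∀ {n E S} → Built n E S → (u : Fin n) → S u ≡ D →
         Built (n + 3) (attach-edges E F4-edges u F4-x) (attach-labels S J4)

Graph : ℕ → Set₁
Graph m = Fin m → Fin m → Set

InT02-012 : ∀ {m} → Graph m → (Fin m → Status) → Set
InT02-012 {m} T S =
  Σ ℕ λ n → Σ (List (Fin n × Fin n)) λ E → Σ (Fin n → Status) λ L →
  Built n E L × Σ (Fin n ⤖ Fin m) λ f →
    (∀ a b → T (Bijection.to f a) (Bijection.to f b) ⇔ ((a , b) ∈ E ⊎ (b , a) ∈ E))
    × (∀ a → S (Bijection.to f a) ≡ L a)

module Submission where

-- A labeling of a built tree is determined by a local condition: every D-vertex has
-- exactly one D-neighbour and every C-vertex exactly two ("balanced").  Each operation
-- preserves balance, because the attached status-C vertex x is invisible to the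
-- D-neighbourhoods of old vertices.  Conversely a balanced labeling of a built tree
-- is forced: the attached copy of F₃ (resp. F₄) ends in pendant paths whose statuses
-- are forced to D, D, C, which makes x of status C, so the labeling restricts to a
-- balanced labeling of the previous tree.  Balance is invariant under isomorphism,
-- so two labelings of T in 𝒯_{02,012} are both balanced and hence equal.

open import Defs
open import Data.Nat using (ℕ; _+_)
open import Data.Fin using (Fin; zero; suc; _↑ˡ_; _↑ʳ_; splitAt; #_)
open import Data.Fin.Properties
  using (↑ˡ-injective; ↑ʳ-injective; splitAt-↑ˡ; splitAt-↑ʳ; splitAt⁻¹-↑ˡ; splitAt⁻¹-↑ʳ)
open import Data.Sum as Sum using (_⊎_; inj₁; inj₂)
open import Data.Product using (_×_; _,_; Σ; proj₁; proj₂)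
open import Data.List using (List; map)
open import Data.List.Relation.Unary.Any using (here; there)
open import Data.List.Membership.Propositional using (_∈_)
open import Data.List.Membership.Propositional.Properties
  using (∈-map⁻; ∈-map⁺; ∈-++⁻; ∈-++⁺ˡ; ∈-++⁺ʳ)
open import Data.Empty using (⊥-elim)
open import Relation.Nullary using (¬_)
open import Relation.Binary.PropositionalEquality using (_≡_; _≢_; refl; sym; trans; cong; subst)
open import Function using (case_of_)
open import Function.Bundles using (_⤖_; _⇔_; mk⇔; Bijection; Equivalence)
import Function.Properties.Equivalence as ⇔

Adj : ∀ {n} → List (Fin n × Fin n) → Graph n
Adj E a b = (a , b) ∈ E ⊎ (b , a) ∈ E

Adj-sym : ∀ {n} {E : List (Fin n × Fin n)} {a b} → Adj E a b → Adj E b a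
Adj-sym = Sum.swap

ExactlyOne : ∀ {m} → (Fin m → Set) → Set
ExactlyOne {m} Q = Σ (Fin m) λ w → Q w × (∀ w′ → Q w′ → w′ ≡ w)

ExactlyTwo : ∀ {m} → (Fin m → Set) → Set
ExactlyTwo {m} Q = Σ (Fin m) λ w₁ → Σ (Fin m) λ w₂ →
  w₁ ≢ w₂ × Q w₁ × Q w₂ × (∀ w′ → Q w′ → w′ ≡ w₁ ⊎ w′ ≡ w₂)

DNeighbour : ∀ {m} → Graph m → (Fin m → Status) → Graph m
DNeighbour A S v w = A v w × S w ≡ D

BalancedAt : ∀ {m} → Graph m → (Fin m → Status) → Fin m → Set
BalancedAt A S v =
  (S v ≡ D → ExactlyOne (DNeighbour A S v)) × (S v ≡ C → ExactlyTwo (DNeighbour A S v))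

Balanced : ∀ {m} → Graph m → (Fin m → Status) → Set
Balanced A S = ∀ v → BalancedAt A S v

C≢D : C ≢ D
C≢D ()

≢C⇒≡D : ∀ {s} → s ≢ C → s ≡ D
≢C⇒≡D {C} s≢C = ⊥-elim (s≢C refl)
≢C⇒≡D {D} _   = refl

≢D⇒≡C : ∀ {s} → s ≢ D → s ≡ C
≢D⇒≡C {C} _   = refl
≢D⇒≡C {D} s≢D = ⊥-elim (s≢D refl)

module _ {a b} (f : Fin a → Fin b) (f-injective : ∀ {x y} → f x ≡ f y → x ≡ y)
         {Q : Fin a → Set} {R : Fin b → Set}
         (Q⇔R∘f : ∀ w → Q w ⇔ R (f w)) (R⊆image : ∀ y → R y → Σ (Fin a) λ w → f w ≡ y) where

  private
    R-preimage : ∀ y → R y → Σ (Fin a) λ w → f w ≡ y × Q w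
    R-preimage y r with R⊆image y r
    ... | w , refl = w , refl , Equivalence.from (Q⇔R∘f w) r

    Q⇒R : ∀ w → Q w → R (f w)
    Q⇒R w = Equivalence.to (Q⇔R∘f w)

  exactlyOne-image : ExactlyOne Q ⇔ ExactlyOne R
  exactlyOne-image = mk⇔ push pull
    where
    push : ExactlyOne Q → ExactlyOne R
    push (w , q , unique) = f w , Q⇒R w q , only
      where
      only : ∀ y → R y → y ≡ f w
      only y r with R-preimage y r
      ... | w′ , refl , q′ = cong f (unique w′ q′)

    pull : ExactlyOne R → ExactlyOne Q
    pull (y , r , unique) with R-preimage y r
    ... | w , refl , q = w , q , λ w′ q′ → f-injective (unique (f w′) (Q⇒R w′ q′))

  exactlyTwo-image : ExactlyTwo Q ⇔ ExactlyTwo R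
  exactlyTwo-image = mk⇔ push pull
    where
    push : ExactlyTwo Q → ExactlyTwo R
    push (w₁ , w₂ , w₁≢w₂ , q₁ , q₂ , unique) =
      f w₁ , f w₂ , (λ eq → w₁≢w₂ (f-injective eq)) , Q⇒R w₁ q₁ , Q⇒R w₂ q₂ , only
      where
      only : ∀ y → R y → y ≡ f w₁ ⊎ y ≡ f w₂
      only y r with R-preimage y r
      ... | w′ , refl , q′ = Sum.map (cong f) (cong f) (unique w′ q′)

    pull : ExactlyTwo R → ExactlyTwo Q
    pull (y₁ , y₂ , y₁≢y₂ , r₁ , r₂ , unique) with R-preimage y₁ r₁ | R-preimage y₂ r₂
    ... | w₁ , refl , q₁ | w₂ , refl , q₂ =
      w₁ , w₂ , (λ eq → y₁≢y₂ (cong f eq)) , q₁ , q₂ ,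
      λ w′ q′ → Sum.map f-injective f-injective (unique (f w′) (Q⇒R w′ q′))

balancedAt-embedding : ∀ {a b} {A : Graph a} {A′ : Graph b} {S : Fin a → Status} {S′ : Fin b → Status}
  (f : Fin a → Fin b) → (∀ {x y} → f x ≡ f y → x ≡ y) →
  (∀ x y → A x y ⇔ A′ (f x) (f y)) → (∀ w → S′ (f w) ≡ S w) → ∀ v →
  (∀ y → A′ (f v) y → S′ y ≡ D → Σ (Fin a) λ w → f w ≡ y) →
  BalancedAt A S v ⇔ BalancedAt A′ S′ (f v)
balancedAt-embedding {A = A} {A′} {S} {S′} f f-injective A⇔A′ S′∘f v covered = mk⇔
  (λ (ifD , ifC) → (λ d → Equivalence.to one (ifD (trans (sym (S′∘f v)) d))) ,
                   (λ c → Equivalence.to two (ifC (trans (sym (S′∘f v)) c))))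
  (λ (ifD , ifC) → (λ d → Equivalence.from one (ifD (trans (S′∘f v) d))) ,
                   (λ c → Equivalence.from two (ifC (trans (S′∘f v) c))))
  where
  DNeighbour⇔ : ∀ w → DNeighbour A S v w ⇔ DNeighbour A′ S′ (f v) (f w)
  DNeighbour⇔ w = mk⇔ (λ (vw , w-D) → Equivalence.to (A⇔A′ v w) vw , trans (S′∘f w) w-D)
                      (λ (vw , w-D) → Equivalence.from (A⇔A′ v w) vw , trans (sym (S′∘f w)) w-D)

  covered′ : ∀ y → DNeighbour A′ S′ (f v) y → Σ _ λ w → f w ≡ y
  covered′ y (vy , y-D) = covered y vy y-D

  one : ExactlyOne (DNeighbour A S v) ⇔ ExactlyOne (DNeighbour A′ S′ (f v))
  one = exactlyOne-image f f-injective DNeighbour⇔ covered′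

  two : ExactlyTwo (DNeighbour A S v) ⇔ ExactlyTwo (DNeighbour A′ S′ (f v))
  two = exactlyTwo-image f f-injective DNeighbour⇔ covered′

↑ˡ≢↑ʳ : ∀ {n k} (a : Fin n) (b : Fin k) → a ↑ˡ k ≢ n ↑ʳ b
↑ˡ≢↑ʳ {n} {k} a b eq
  with trans (sym (splitAt-↑ˡ n a k)) (trans (cong (splitAt n) eq) (splitAt-↑ʳ n k b))
... | ()

data SplitView (n k : ℕ) : Fin (n + k) → Set where
  left  : (a : Fin n) → SplitView n k (a ↑ˡ k)
  right : (b : Fin k) → SplitView n k (n ↑ʳ b)

splitView : ∀ n k (v : Fin (n + k)) → SplitView n k v
splitView n k v with splitAt n v in eq
... | inj₁ a = subst (SplitView n k) (splitAt⁻¹-↑ˡ eq) (left a)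
... | inj₂ b = subst (SplitView n k) (splitAt⁻¹-↑ʳ eq) (right b)

attach-labels-↑ˡ : ∀ {n k} (S : Fin n → Status) (J : Fin k → Status) a → attach-labels S J (a ↑ˡ k) ≡ S a
attach-labels-↑ˡ {n} {k} S J a rewrite splitAt-↑ˡ n a k = refl

attach-labels-↑ʳ : ∀ {n k} (S : Fin n → Status) (J : Fin k → Status) b → attach-labels S J (n ↑ʳ b) ≡ J b
attach-labels-↑ʳ {n} {k} S J b rewrite splitAt-↑ʳ n k b = refl

≗-attach-labels : ∀ {n k} {S′ : Fin (n + k) → Status} {S : Fin n → Status} {J : Fin k → Status} →
  (∀ a → S′ (a ↑ˡ k) ≡ S a) → (∀ b → S′ (n ↑ʳ b) ≡ J b) → ∀ v → S′ v ≡ attach-labels S J v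
≗-attach-labels {n} {k} {S = S} {J} on-old on-new v with splitView n k v
... | left a  = trans (on-old a) (sym (attach-labels-↑ˡ S J a))
... | right b = trans (on-new b) (sym (attach-labels-↑ʳ S J b))

module Attach {n k : ℕ} (E : List (Fin n × Fin n)) (F : List (Fin k × Fin k)) (u : Fin n) (x : Fin k) where

  G : List (Fin (n + k) × Fin (n + k))
  G = attach-edges E F u x

  data AttachedEdge (p q : Fin (n + k)) : Set where
    bridge   : p ≡ u ↑ˡ k → q ≡ n ↑ʳ x → AttachedEdge p q
    old-edge : ∀ {a b} → (a , b) ∈ E → p ≡ a ↑ˡ k → q ≡ b ↑ˡ k → AttachedEdge p q
    new-edge : ∀ {a b} → (a , b) ∈ F → p ≡ n ↑ʳ a → q ≡ n ↑ʳ b → AttachedEdge p q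

  ∈-attach⁻ : ∀ {p q} → (p , q) ∈ G → AttachedEdge p q
  ∈-attach⁻ (here refl) = bridge refl refl
  ∈-attach⁻ (there pq∈) with ∈-++⁻ (map (old k) E) pq∈
  ... | inj₁ pq∈old with ∈-map⁻ (old k) pq∈old
  ...   | (a , b) , ab∈E , refl = old-edge ab∈E refl refl
  ∈-attach⁻ (there pq∈) | inj₂ pq∈new with ∈-map⁻ (new n) pq∈new
  ...   | (a , b) , ab∈F , refl = new-edge ab∈F refl refl

  old-∈⁺ : ∀ {a b} → (a , b) ∈ E → (a ↑ˡ k , b ↑ˡ k) ∈ G
  old-∈⁺ ab∈E = there (∈-++⁺ˡ (∈-map⁺ (old k) ab∈E))

  new-∈⁺ : ∀ {a b} → (a , b) ∈ F → (n ↑ʳ a , n ↑ʳ b) ∈ G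
  new-∈⁺ ab∈F = there (∈-++⁺ʳ (map (old k) E) (∈-map⁺ (new n) ab∈F))

  old-∈⁻ : ∀ {a b} → (a ↑ˡ k , b ↑ˡ k) ∈ G → (a , b) ∈ E
  old-∈⁻ ab∈G with ∈-attach⁻ ab∈G
  ... | bridge _ q≡ = ⊥-elim (↑ˡ≢↑ʳ _ _ q≡)
  ... | new-edge _ p≡ _ = ⊥-elim (↑ˡ≢↑ʳ _ _ p≡)
  ... | old-edge ab∈E p≡ q≡ with ↑ˡ-injective k _ _ p≡ | ↑ˡ-injective k _ _ q≡
  ...   | refl | refl = ab∈E

  new-∈⁻ : ∀ {a b} → (n ↑ʳ a , n ↑ʳ b) ∈ G → (a , b) ∈ F
  new-∈⁻ ab∈G with ∈-attach⁻ ab∈G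
  ... | bridge p≡ _ = ⊥-elim (↑ˡ≢↑ʳ _ _ (sym p≡))
  ... | old-edge _ p≡ _ = ⊥-elim (↑ˡ≢↑ʳ _ _ (sym p≡))
  ... | new-edge ab∈F p≡ q≡ with ↑ʳ-injective n _ _ p≡ | ↑ʳ-injective n _ _ q≡
  ...   | refl | refl = ab∈F

  cross-∈⁻ : ∀ {c b} → (c ↑ˡ k , n ↑ʳ b) ∈ G → c ≡ u × b ≡ x
  cross-∈⁻ cb∈G with ∈-attach⁻ cb∈G
  ... | bridge p≡ q≡ = ↑ˡ-injective k _ _ p≡ , ↑ʳ-injective n _ _ q≡
  ... | old-edge _ _ q≡ = ⊥-elim (↑ˡ≢↑ʳ _ _ (sym q≡))
  ... | new-edge _ p≡ _ = ⊥-elim (↑ˡ≢↑ʳ _ _ p≡)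

  cross-∉ : ∀ {c b} → ¬ (n ↑ʳ b , c ↑ˡ k) ∈ G
  cross-∉ bc∈G with ∈-attach⁻ bc∈G
  ... | bridge p≡ _ = ↑ˡ≢↑ʳ _ _ (sym p≡)
  ... | old-edge _ p≡ _ = ↑ˡ≢↑ʳ _ _ (sym p≡)
  ... | new-edge _ _ q≡ = ↑ˡ≢↑ʳ _ _ q≡

  old-adj : ∀ a b → Adj E a b ⇔ Adj G (a ↑ˡ k) (b ↑ˡ k)
  old-adj a b = mk⇔ (Sum.map old-∈⁺ old-∈⁺) (Sum.map old-∈⁻ old-∈⁻)

  new-adj : ∀ a b → Adj F a b ⇔ Adj G (n ↑ʳ a) (n ↑ʳ b)
  new-adj a b = mk⇔ (Sum.map new-∈⁺ new-∈⁺) (Sum.map new-∈⁻ new-∈⁻)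

  bridge-adj : Adj G (u ↑ˡ k) (n ↑ʳ x)
  bridge-adj = inj₁ (here refl)

  cross-adj⁻ : ∀ {c b} → Adj G (c ↑ˡ k) (n ↑ʳ b) → c ≡ u × b ≡ x
  cross-adj⁻ (inj₁ cb∈G) = cross-∈⁻ cb∈G
  cross-adj⁻ (inj₂ bc∈G) = ⊥-elim (cross-∉ bc∈G)

  old-neighbour : ∀ {a} y → Adj G (a ↑ˡ k) y → (Σ (Fin n) λ c → y ≡ c ↑ˡ k) ⊎ y ≡ n ↑ʳ x
  old-neighbour y ay with splitView n k y
  ... | left c = inj₁ (c , refl)
  ... | right b with cross-adj⁻ ay
  ...   | _ , refl = inj₂ refl

  new-neighbour : ∀ {a} y → Adj G (n ↑ʳ a) y →
    (y ≡ u ↑ˡ k × a ≡ x) ⊎ (Σ (Fin k) λ b → y ≡ n ↑ʳ b × Adj F a b)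
  new-neighbour {a} y ay with splitView n k y
  ... | left c with cross-adj⁻ (Adj-sym {E = G} ay)
  ...   | refl , a≡x = inj₁ (refl , a≡x)
  new-neighbour {a} y ay | right b = inj₂ (b , refl , Equivalence.from (new-adj a b) ay)

  new-pendant : ∀ {a c} → a ≢ x → (∀ b → Adj F a b → b ≡ c) → ∀ y → Adj G (n ↑ʳ a) y → y ≡ n ↑ʳ c
  new-pendant a≢x only-c y ay with new-neighbour y ay
  ... | inj₁ (_ , a≡x) = ⊥-elim (a≢x a≡x)
  ... | inj₂ (b , refl , ab) = cong (n ↑ʳ_) (only-c b ab)

  balancedAt-old : ∀ {S′ : Fin (n + k) → Status} {S : Fin n → Status} → S′ (n ↑ʳ x) ≡ C →
    (∀ w → S′ (w ↑ˡ k) ≡ S w) → ∀ a → BalancedAt (Adj E) S a ⇔ BalancedAt (Adj G) S′ (a ↑ˡ k)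
  balancedAt-old {S′} x-C S′↑ˡ a =
    balancedAt-embedding {A = Adj E} {Adj G} (_↑ˡ k) (↑ˡ-injective k _ _) old-adj S′↑ˡ a covered
    where
    covered : ∀ y → Adj G (a ↑ˡ k) y → S′ y ≡ D → Σ (Fin n) λ c → c ↑ˡ k ≡ y
    covered y ay y-D with old-neighbour y ay
    ... | inj₁ (c , refl) = c , refl
    ... | inj₂ refl = ⊥-elim (C≢D (trans (sym x-C) y-D))

  balancedAt-new : ∀ {S : Fin n → Status} {J : Fin k → Status} {a} → (a ≡ x → S u ≢ D) →
    BalancedAt (Adj F) J a → BalancedAt (Adj G) (attach-labels S J) (n ↑ʳ a)
  balancedAt-new {S} {J} {a} bridge-not-D = Equivalence.to
    (balancedAt-embedding {A = Adj F} {Adj G} (n ↑ʳ_) (↑ʳ-injective n _ _) new-adj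
      (attach-labels-↑ʳ S J) a covered)
    where
    covered : ∀ y → Adj G (n ↑ʳ a) y → attach-labels S J y ≡ D → Σ (Fin k) λ b → n ↑ʳ b ≡ y
    covered y ay y-D with new-neighbour y ay
    ... | inj₁ (refl , a≡x) = ⊥-elim (bridge-not-D a≡x (trans (sym (attach-labels-↑ˡ S J u)) y-D))
    ... | inj₂ (b , refl , _) = b , refl

-- A pendant vertex a has too few neighbours to be C; its D-neighbour b then already
-- has a as its only D-neighbour, so every other neighbour c of b is C.
pendant-path-forced : ∀ {m} {A : Graph m} {S : Fin m → Status} {a b c : Fin m} → Balanced A S →
  A a b → A b a → (∀ y → A a y → y ≡ b) → A b c → c ≢ a → S a ≡ D × S b ≡ D × S c ≡ C
pendant-path-forced {S = S} {a} {b} {c} bal ab ba only-b bc c≢a = a-D , b-D , c-C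
  where
  a-D : S a ≡ D
  a-D = ≢C⇒≡D λ a-C →
    let (w₁ , w₂ , w₁≢w₂ , (aw₁ , _) , (aw₂ , _) , _) = proj₂ (bal a) a-C
    in w₁≢w₂ (trans (only-b w₁ aw₁) (sym (only-b w₂ aw₂)))

  b-D : S b ≡ D
  b-D = let (w , (aw , w-D) , _) = proj₁ (bal a) a-D in subst (λ z → S z ≡ D) (only-b w aw) w-D

  c-C : S c ≡ C
  c-C = ≢D⇒≡C λ c-D →
    let (_ , _ , unique) = proj₁ (bal b) b-D
    in c≢a (trans (unique c (bc , c-D)) (sym (unique a (ba , a-D))))

data F3-Adj : Fin 5 → Fin 5 → Set where
  e01 : F3-Adj (# 0) (# 1)
  e10 : F3-Adj (# 1) (# 0)
  e12 : F3-Adj (# 1) (# 2)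
  e21 : F3-Adj (# 2) (# 1)
  e23 : F3-Adj (# 2) (# 3)
  e32 : F3-Adj (# 3) (# 2)
  e34 : F3-Adj (# 3) (# 4)
  e43 : F3-Adj (# 4) (# 3)

F3-adj⁺ : ∀ {a b} → F3-Adj a b → Adj F3-edges a b
F3-adj⁺ e01 = inj₁ (here refl)
F3-adj⁺ e12 = inj₁ (there (here refl))
F3-adj⁺ e23 = inj₁ (there (there (here refl)))
F3-adj⁺ e34 = inj₁ (there (there (there (here refl))))
F3-adj⁺ e10 = inj₂ (here refl)
F3-adj⁺ e21 = inj₂ (there (here refl))
F3-adj⁺ e32 = inj₂ (there (there (here refl)))
F3-adj⁺ e43 = inj₂ (there (there (there (here refl))))

F3-adj⁻ : ∀ {a b} → Adj F3-edges a b → F3-Adj a b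
F3-adj⁻ (inj₁ (here refl)) = e01
F3-adj⁻ (inj₁ (there (here refl))) = e12
F3-adj⁻ (inj₁ (there (there (here refl)))) = e23
F3-adj⁻ (inj₁ (there (there (there (here refl))))) = e34
F3-adj⁻ (inj₁ (there (there (there (there ())))))
F3-adj⁻ (inj₂ (here refl)) = e10
F3-adj⁻ (inj₂ (there (here refl))) = e21
F3-adj⁻ (inj₂ (there (there (here refl)))) = e32
F3-adj⁻ (inj₂ (there (there (there (here refl))))) = e43
F3-adj⁻ (inj₂ (there (there (there (there ())))))

data F4-Adj : Fin 3 → Fin 3 → Set where
  f01 : F4-Adj (# 0) (# 1)
  f10 : F4-Adj (# 1) (# 0)
  f12 : F4-Adj (# 1) (# 2)
  f21 : F4-Adj (# 2) (# 1)

F4-adj⁺ : ∀ {a b} → F4-Adj a b → Adj F4-edges a b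
F4-adj⁺ f01 = inj₁ (here refl)
F4-adj⁺ f12 = inj₁ (there (here refl))
F4-adj⁺ f10 = inj₂ (here refl)
F4-adj⁺ f21 = inj₂ (there (here refl))

F4-adj⁻ : ∀ {a b} → Adj F4-edges a b → F4-Adj a b
F4-adj⁻ (inj₁ (here refl)) = f01
F4-adj⁻ (inj₁ (there (here refl))) = f12
F4-adj⁻ (inj₁ (there (there ())))
F4-adj⁻ (inj₂ (here refl)) = f10
F4-adj⁻ (inj₂ (there (here refl))) = f21
F4-adj⁻ (inj₂ (there (there ())))

F3-pendant₀ : ∀ b → Adj F3-edges (# 0) b → b ≡ # 1
F3-pendant₀ b ab with F3-adj⁻ ab
... | e01 = refl

F3-pendant₄ : ∀ b → Adj F3-edges (# 4) b → b ≡ # 3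
F3-pendant₄ b ab with F3-adj⁻ ab
... | e43 = refl

F4-pendant₂ : ∀ b → Adj F4-edges (# 2) b → b ≡ # 1
F4-pendant₂ b ab with F4-adj⁻ ab
... | f21 = refl

F3-forced : ∀ {m} {A : Graph m} {S : Fin m → Status} (g : Fin 5 → Fin m) → Balanced A S →
  (∀ {a b} → g a ≡ g b → a ≡ b) → (∀ {a b} → F3-Adj a b → A (g a) (g b)) →
  (∀ y → A (g (# 0)) y → y ≡ g (# 1)) → (∀ y → A (g (# 4)) y → y ≡ g (# 3)) →
  ∀ a → S (g a) ≡ J3 a
F3-forced {S = S} g bal g-injective g-adj pendant₀ pendant₄ = forced
  where
  path-0-1-2 : S (g (# 0)) ≡ D × S (g (# 1)) ≡ D × S (g (# 2)) ≡ C
  path-0-1-2 = pendant-path-forced bal (g-adj e01) (g-adj e10) pendant₀ (g-adj e12)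
    λ eq → case g-injective eq of λ ()

  path-4-3-2 : S (g (# 4)) ≡ D × S (g (# 3)) ≡ D × S (g (# 2)) ≡ C
  path-4-3-2 = pendant-path-forced bal (g-adj e43) (g-adj e34) pendant₄ (g-adj e32)
    λ eq → case g-injective eq of λ ()

  forced : ∀ a → S (g a) ≡ J3 a
  forced zero                          = proj₁ path-0-1-2
  forced (suc zero)                    = proj₁ (proj₂ path-0-1-2)
  forced (suc (suc zero))              = proj₂ (proj₂ path-0-1-2)
  forced (suc (suc (suc zero)))        = proj₁ (proj₂ path-4-3-2)
  forced (suc (suc (suc (suc zero))))  = proj₁ path-4-3-2

F4-forced : ∀ {m} {A : Graph m} {S : Fin m → Status} (g : Fin 3 → Fin m) → Balanced A S →
  (∀ {a b} → g a ≡ g b → a ≡ b) → (∀ {a b} → F4-Adj a b → A (g a) (g b)) →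
  (∀ y → A (g (# 2)) y → y ≡ g (# 1)) → ∀ a → S (g a) ≡ J4 a
F4-forced {S = S} g bal g-injective g-adj pendant₂ = forced
  where
  path-2-1-0 : S (g (# 2)) ≡ D × S (g (# 1)) ≡ D × S (g (# 0)) ≡ C
  path-2-1-0 = pendant-path-forced bal (g-adj f21) (g-adj f12) pendant₂ (g-adj f10)
    λ eq → case g-injective eq of λ ()

  forced : ∀ a → S (g a) ≡ J4 a
  forced zero             = proj₂ (proj₂ path-2-1-0)
  forced (suc zero)       = proj₁ (proj₂ path-2-1-0)
  forced (suc (suc zero)) = proj₁ path-2-1-0

F3-balanced : Balanced (Adj F3-edges) J3
F3-balanced zero = (λ _ → # 1 , (F3-adj⁺ e01 , refl) , λ w (aw , _) → F3-pendant₀ w aw) , λ ()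
F3-balanced (suc zero) = (λ _ → # 0 , (F3-adj⁺ e10 , refl) , only) , λ ()
  where
  only : ∀ w → DNeighbour (Adj F3-edges) J3 (# 1) w → w ≡ # 0
  only w (aw , w-D) with F3-adj⁻ aw
  ... | e10 = refl
  ... | e12 = ⊥-elim (C≢D w-D)
F3-balanced (suc (suc zero)) =
  (λ ()) , λ _ → # 1 , # 3 , (λ ()) , (F3-adj⁺ e21 , refl) , (F3-adj⁺ e23 , refl) , only
  where
  only : ∀ w → DNeighbour (Adj F3-edges) J3 (# 2) w → w ≡ # 1 ⊎ w ≡ # 3
  only w (aw , _) with F3-adj⁻ aw
  ... | e21 = inj₁ refl
  ... | e23 = inj₂ refl
F3-balanced (suc (suc (suc zero))) = (λ _ → # 4 , (F3-adj⁺ e34 , refl) , only) , λ ()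
  where
  only : ∀ w → DNeighbour (Adj F3-edges) J3 (# 3) w → w ≡ # 4
  only w (aw , w-D) with F3-adj⁻ aw
  ... | e34 = refl
  ... | e32 = ⊥-elim (C≢D w-D)
F3-balanced (suc (suc (suc (suc zero)))) =
  (λ _ → # 3 , (F3-adj⁺ e43 , refl) , λ w (aw , _) → F3-pendant₄ w aw) , λ ()

F4-balancedAt-suc : ∀ a → BalancedAt (Adj F4-edges) J4 (suc a)
F4-balancedAt-suc zero = (λ _ → # 2 , (F4-adj⁺ f12 , refl) , only) , λ ()
  where
  only : ∀ w → DNeighbour (Adj F4-edges) J4 (# 1) w → w ≡ # 2
  only w (aw , w-D) with F4-adj⁻ aw
  ... | f12 = refl
  ... | f10 = ⊥-elim (C≢D w-D)
F4-balancedAt-suc (suc zero) = (λ _ → # 1 , (F4-adj⁺ f21 , refl) , λ w (aw , _) → F4-pendant₂ w aw) , λ ()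

module _ {n} {E : List (Fin n × Fin n)} {S : Fin n → Status} {u : Fin n} (u-D : S u ≡ D) where
  open Attach E F4-edges u F4-x

  F4-x-balancedAt : BalancedAt (Adj G) (attach-labels S J4) (n ↑ʳ F4-x)
  F4-x-balancedAt = (λ x-D → ⊥-elim (C≢D (trans (sym (attach-labels-↑ʳ S J4 F4-x)) x-D))) , λ _ →
    n ↑ʳ # 1 , u ↑ˡ 3 , (λ eq → ↑ˡ≢↑ʳ u (# 1) (sym eq)) ,
    (Equivalence.to (new-adj (# 0) (# 1)) (F4-adj⁺ f01) , attach-labels-↑ʳ S J4 (# 1)) ,
    (Adj-sym {E = G} bridge-adj , trans (attach-labels-↑ˡ S J4 u) u-D) , only
    where
    only : ∀ w → DNeighbour (Adj G) (attach-labels S J4) (n ↑ʳ F4-x) w → w ≡ n ↑ʳ # 1 ⊎ w ≡ u ↑ˡ 3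
    only w (xw , _) with new-neighbour w xw
    ... | inj₁ (refl , _) = inj₂ refl
    ... | inj₂ (b , refl , xb) with F4-adj⁻ xb
    ...   | f01 = inj₁ refl

built-balanced : ∀ {n E L} → Built n E L → Balanced (Adj E) L
built-balanced base = F3-balanced
built-balanced (O9 {n} {E} {S} b u u-C) = balanced
  where
  open Attach E F3-edges u F3-x

  balanced : Balanced (Adj G) (attach-labels S J3)
  balanced v with splitView n 5 v
  ... | left a = Equivalence.to
    (balancedAt-old (attach-labels-↑ʳ S J3 F3-x) (attach-labels-↑ˡ S J3) a) (built-balanced b a)
  ... | right a = balancedAt-new (λ _ u-D → C≢D (trans (sym u-C) u-D)) (F3-balanced a)
built-balanced (O10 {n} {E} {S} b u u-D) = balanced
  where
  open Attach E F4-edges u F4-x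

  balanced : Balanced (Adj G) (attach-labels S J4)
  balanced v with splitView n 3 v
  ... | left a = Equivalence.to
    (balancedAt-old (attach-labels-↑ʳ S J4 F4-x) (attach-labels-↑ˡ S J4) a) (built-balanced b a)
  ... | right zero = F4-x-balancedAt u-D
  ... | right (suc a) = balancedAt-new (λ ()) (F4-balancedAt-suc a)

built-balanced-unique : ∀ {n E L} → Built n E L → ∀ S′ → Balanced (Adj E) S′ → ∀ v → S′ v ≡ L v
built-balanced-unique base S′ bal =
  F3-forced (λ a → a) bal (λ eq → eq) F3-adj⁺ F3-pendant₀ F3-pendant₄
built-balanced-unique (O9 {n} {E} {S} b u _) S′ bal = ≗-attach-labels old-forced new-forced
  where
  open Attach E F3-edges u F3-x

  new-forced : ∀ a → S′ (n ↑ʳ a) ≡ J3 a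
  new-forced = F3-forced (n ↑ʳ_) bal (↑ʳ-injective n _ _)
    (λ ab → Equivalence.to (new-adj _ _) (F3-adj⁺ ab))
    (new-pendant (λ ()) F3-pendant₀) (new-pendant (λ ()) F3-pendant₄)

  old-forced : ∀ a → S′ (a ↑ˡ 5) ≡ S a
  old-forced = built-balanced-unique b (λ w → S′ (w ↑ˡ 5))
    (λ a → Equivalence.from (balancedAt-old (new-forced F3-x) (λ _ → refl) a) (bal (a ↑ˡ 5)))
built-balanced-unique (O10 {n} {E} {S} b u _) S′ bal = ≗-attach-labels old-forced new-forced
  where
  open Attach E F4-edges u F4-x

  new-forced : ∀ a → S′ (n ↑ʳ a) ≡ J4 a
  new-forced = F4-forced (n ↑ʳ_) bal (↑ʳ-injective n _ _)
    (λ ab → Equivalence.to (new-adj _ _) (F4-adj⁺ ab))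
    (new-pendant (λ ()) F4-pendant₂)

  old-forced : ∀ a → S′ (a ↑ˡ 3) ≡ S a
  old-forced = built-balanced-unique b (λ w → S′ (w ↑ˡ 3))
    (λ a → Equivalence.from (balancedAt-old (new-forced F4-x) (λ _ → refl) a) (bal (a ↑ˡ 3)))

balanced-⤖ : ∀ {m n} {T : Graph m} {E : List (Fin n × Fin n)} {S : Fin m → Status} {L : Fin n → Status}
  (f : Fin n ⤖ Fin m) → (∀ a b → T (Bijection.to f a) (Bijection.to f b) ⇔ Adj E a b) →
  (∀ a → S (Bijection.to f a) ≡ L a) → Balanced (Adj E) L ⇔ Balanced T S
balanced-⤖ {T = T} {E} {S} {L} f T≅E S∘f≡L = mk⇔ push pull
  where
  open Bijection f using (to; injective; strictlySurjective)

  at : ∀ a → BalancedAt (Adj E) L a ⇔ BalancedAt T S (to a)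
  at a = balancedAt-embedding {A = Adj E} {T} to injective (λ x y → ⇔.sym (T≅E x y)) S∘f≡L a
    (λ y _ _ → strictlySurjective y)

  push : Balanced (Adj E) L → Balanced T S
  push bal v with strictlySurjective v
  ... | a , refl = Equivalence.to (at a) (bal a)

  pull : Balanced T S → Balanced (Adj E) L
  pull bal a = Equivalence.from (at a) (bal (to a))

corollary6p7 : ∀ {m : ℕ} (T : Graph m) (S₁ S₂ : Fin m → Status) →
    InT02-012 T S₁ → InT02-012 T S₂ → ∀ v → S₁ v ≡ S₂ v
corollary6p7 T S₁ S₂ (_ , _ , _ , B₁ , f₁ , T≅₁ , S₁≡L₁) (_ , E₂ , _ , B₂ , f₂ , T≅₂ , S₂≡L₂) v
  with Bijection.strictlySurjective f₂ v
... | a , refl = trans (built-balanced-unique B₂ _ S₁-balanced-on-E₂ a) (sym (S₂≡L₂ a))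
  where
  S₁-balanced : Balanced T S₁
  S₁-balanced = Equivalence.to (balanced-⤖ f₁ T≅₁ S₁≡L₁) (built-balanced B₁)

  S₁-balanced-on-E₂ : Balanced (Adj E₂) (λ a → S₁ (Bijection.to f₂ a))
  S₁-balanced-on-E₂ = Equivalence.from (balanced-⤖ f₂ T≅₂ (λ _ → refl)) S₁-balanced
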